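{- For real numbers $Q_1,Q_2,\dots$ let $A_n$ be the adjacency matrix of the path on vertices $1,2,\dots,n$ (so $(A_n)_{i,i+1}=(A_n)_{i+1,i}=1$ and all other entries $0$), and let $p_n(x) = p_n(x;Q_1,\dots,Q_n) = \det(xI_n - A_n - \operatorname{diag}(Q_1,\dots,Q_n))$, with the conventions $p_0 = 1$, $p_{ -1} = 0$. Let $L_{2n} = p_{2n}(x;Q_1,\dots,Q_n,Q_n,\dots,Q_1)$ and $L_{2n+1} = p_{2n+1}(x;Q_1,\dots,Q_n,Q_{n+1},Q_n,\dots,Q_1)$. Then, writing $p_k$ for $p_k(x;Q_1,\dots,Q_k)$, (1) $p_n = (x - Q_n)\,p_{n-1} - p_{n-2}$; (2) $L_{2n} = (p_n + p_{n-1})(p_n - p_{n-1})$; (3) $L_{2n+1} = p_n\,(p_{n+1} - p_{n-1})$. Moreover, in (2) (respectively (3)), with $N = 2n$ (respectively $N=2n+1$) and $H = A_N + \operatorname{diag}$ of the corresponding symmetric potential, the roots of the first factor are eigenvalues of $H$ with eigenvectors $f$ satisfying $f(1) = -f(N) \neq 0$, and the roots of the second factor are eigenvalues of $H$ with eigenvectors $f$ satisfying $f(1) = f(N) \neq 0$. -}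

module Defs where

open import Level using (Level)
open import Data.Nat as ℕ using (ℕ; zero; suc; _⊓_; _∸_)
open import Data.Fin as Fin using (Fin; toℕ; punchIn)
open import Data.Bool using (if_then_else_)
open import Relation.Nullary.Decidable using (⌊_⌋)
open import Relation.Nullary using (¬_)
open import Data.Product using (Σ; _×_; ∃)
open import Algebra.Bundles using (CommutativeRing)

record IsField {c ℓ : Level} (R : CommutativeRing c ℓ) : Set (Level._⊔_ c ℓ) where
  open CommutativeRing R
  field
    1≉0     : ¬ (1# ≈ 0#)
    inverse : ∀ a → ¬ (a ≈ 0#) → ∃ λ b → a * b ≈ 1#

module LinAlg {c ℓ : Level} (R : CommutativeRing c ℓ) where
  open CommutativeRing R

  Matrix : ℕ → Set c
  Matrix n = Fin n → Fin n → Carrier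

  sumFin : ∀ n → (Fin n → Carrier) → Carrier
  sumFin zero    f = 0#
  sumFin (suc n) f = f Fin.zero + sumFin n (λ i → f (Fin.suc i))

  sign : ℕ → Carrier
  sign zero    = 1#
  sign (suc k) = - sign k

  minor : ∀ {n} → Matrix (suc n) → Fin (suc n) → Matrix n
  minor M j i k = M (Fin.suc i) (punchIn j k)

  det : ∀ n → Matrix n → Carrier
  det zero    M = 1#
  det (suc n) M = sumFin (suc n) (λ j → sign (toℕ j) * (M Fin.zero j * det n (minor M j)))

  _·ᵥ_ : ∀ {n} → Matrix n → (Fin n → Carrier) → (Fin n → Carrier)
  _·ᵥ_ {n} M f i = sumFin n (λ j → M i j * f j)

  _⊕_ : ∀ {n} → Matrix n → Matrix n → Matrix n
  (M ⊕ N) i j = M i j + N i j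

  _⊖_ : ∀ {n} → Matrix n → Matrix n → Matrix n
  (M ⊖ N) i j = M i j - N i j

  scalarI : ∀ n → Carrier → Matrix n
  scalarI n a i j = if ⌊ i Fin.≟ j ⌋ then a else 0#

  -- adjacency matrix of the path on vertices 1,…,n
  -- (vertex k corresponds to the index i : Fin n with toℕ i + 1 = k)
  pathAdj : ∀ n → Matrix n
  pathAdj n i j =
    if ⌊ toℕ j ℕ.≟ suc (toℕ i) ⌋ then 1#
    else if ⌊ toℕ i ℕ.≟ suc (toℕ j) ⌋ then 1# else 0#

  -- diag(V 1, …, V n); the potential V is indexed from 1 (V 0 is unused)
  diagPot : ∀ n → (ℕ → Carrier) → Matrix n
  diagPot n V i j = if ⌊ i Fin.≟ j ⌋ then V (suc (toℕ i)) else 0#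

  H : ∀ n → (ℕ → Carrier) → Matrix n
  H n V = pathAdj n ⊕ diagPot n V

  charP : ∀ n → (ℕ → Carrier) → Carrier → Carrier
  charP n V x = det n ((scalarI n x ⊖ pathAdj n) ⊖ diagPot n V)

  -- shifted family with the convention p_{-1} = 0:
  -- pShift V x 0 = p_{-1} = 0,  pShift V x (suc k) = p_k
  pShift : (ℕ → Carrier) → Carrier → ℕ → Carrier
  pShift V x zero    = 0#
  pShift V x (suc k) = charP k V x

  -- symmetric potential of length N built from Q:
  -- position k (1 ≤ k ≤ N) gets Q (min k (N + 1 − k)), i.e.
  -- Q_1,…,Q_n,Q_n,…,Q_1 for N = 2n and Q_1,…,Q_n,Q_{n+1},Q_n,…,Q_1 for N = 2n+1
  symPot : ℕ → (ℕ → Carrier) → (ℕ → Carrier)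
  symPot N Q k = Q (k ⊓ (suc N ∸ k))

  firstV : ∀ m → Fin (suc m)
  firstV m = Fin.zero

  lastV : ∀ m → Fin (suc m)
  lastV m = Fin.fromℕ m

  IsEigenvector : ∀ n → Matrix n → Carrier → (Fin n → Carrier) → Set ℓ
  IsEigenvector n M λ' f = (∃ λ i → ¬ (f i ≈ 0#)) × (∀ i → (M ·ᵥ f) i ≈ λ' * f i)

  -- λ is an eigenvalue of M (on a path with suc m vertices) with an
  -- eigenvector f satisfying f(1) = s(f(N)) ≠ 0, and every eigenvector
  -- for λ satisfies f(1) = s(f(N)) ≠ 0   (s = id or s = negation)
  EigenWithBoundary : ∀ m → Matrix (suc m) → Carrier → (Carrier → Carrier) → Set (Level._⊔_ c ℓ)
  EigenWithBoundary m M λ' s =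
    (∃ λ f → IsEigenvector (suc m) M λ' f
            × (f (firstV m) ≈ s (f (lastV m))) × ¬ (f (firstV m) ≈ 0#))
    × (∀ f → IsEigenvector (suc m) M λ' f
            → (f (firstV m) ≈ s (f (lastV m))) × ¬ (f (firstV m) ≈ 0#))

twice : ℕ → ℕ
twice n = n ℕ.+ n

module Submission where

-- The characteristic polynomials p_k = det (x I − A_k − diag(V₁,…,V_k)) of a
-- path are continuants: with  P V 0 = 0, P V 1 = 1 and
--   P V (k+2) = (x − V(k+1)) P V (k+1) − P V k,
-- p_k = P V (k+1).
--
--  * index arithmetic for the symmetric potential and routine ring identities;
--  * a first-row expansion of tridiagonal determinants, giving the front
--    recurrence  p_{n+2}(V) = (x − V₁) p_{n+1}(V∘suc) − p_n(V∘suc∘suc);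
--  * the splitting formula  p_{m+k}(V) = p_m(V) p_k(V after m)
--      − p_{m−1}(V) p_{k−1}(V after m+1),  whence p_n = P V (n+1) (part (1))
--    and invariance of p_n under reversing the potential; cutting the
--    symmetric potential in the middle then yields parts (2) and (3);
--  * the eigenvalue equation H f = λ f is the three-term recurrence, so an
--    eigenvector is f(1) times the continuant solution; gluing that solution
--    with its mirror image scaled by σ = ∓1 gives an eigenvector as soon as
--    the two halves match at the seam, and the vanishing of each factor in
--    (2) and (3) is exactly such a matching condition.

open import Defs
open import Data.Nat as ℕ using (ℕ; zero; suc; _≤_; _<_; z≤n; s≤s; _⊓_; _∸_)
import Data.Nat.Properties as ℕP
open import Data.Fin as Fin using (Fin; toℕ; punchIn; punchOut)
import Data.Fin.Properties as FinP
open import Data.Product using (_×_; _,_; proj₁; proj₂)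
open import Data.Sum using (inj₁; inj₂)
open import Data.Bool using (true; false; if_then_else_)
open import Relation.Nullary using (¬_; yes; no; Dec; _because_)
open import Relation.Nullary.Decidable using (⌊_⌋; isYes; map′)
open import Relation.Binary.PropositionalEquality as ≡ using (_≡_)
open import Data.Empty using (⊥-elim)
open import Algebra.Bundles using (CommutativeRing)
open import Function using (id)

-- Vertex j of a path with N vertices is mirrored to vertex suc N ∸ j; the
-- symmetric potential symPot N Q reads Q at the smaller of the two indices.

nearer-lower : ∀ N k → k ℕ.+ k < N → suc k ⊓ (suc N ∸ suc k) ≡ suc k
nearer-lower N k k+k<N = ℕP.m≤n⇒m⊓n≡m (ℕP.m+n≤o⇒m≤o∸n (suc k) bound)
  where
  bound : suc k ℕ.+ suc k ≤ suc N
  bound = s≤s (ℕP.≤-trans (ℕP.≤-reflexive (ℕP.+-suc k k)) k+k<N)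

nearer-upper : ∀ N j k → j ℕ.+ k ≡ suc N → k ≤ j → j ⊓ (suc N ∸ j) ≡ k
nearer-upper N j k sum k≤j =
  ≡.trans (ℕP.m≥n⇒m⊓n≡n (≡.subst (_≤ j) (≡.sym mirror) k≤j)) mirror
  where
  mirror : suc N ∸ j ≡ k
  mirror = ≡.trans (≡.cong (_∸ j) (≡.sym sum)) (ℕP.m+n∸m≡n j k)

-- Vertex m + (j+1), read from the far end of a path of N = m + k vertices,
-- is vertex k ∸ j.
mirrored-pair : ∀ m k j → j ≤ k → (m ℕ.+ suc j) ℕ.+ (k ∸ j) ≡ suc (m ℕ.+ k)
mirrored-pair m k j j≤k = begin
  (m ℕ.+ suc j) ℕ.+ (k ∸ j) ≡⟨ ℕP.+-assoc m (suc j) (k ∸ j) ⟩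
  m ℕ.+ suc (j ℕ.+ (k ∸ j)) ≡⟨ ≡.cong (λ t → m ℕ.+ suc t) (ℕP.m+[n∸m]≡n j≤k) ⟩
  m ℕ.+ suc k               ≡⟨ ℕP.+-suc m k ⟩
  suc (m ℕ.+ k)             ∎
  where open ≡.≡-Reasoning

∸-suc : ∀ N k → k < N → N ∸ k ≡ suc (N ∸ suc k)
∸-suc (suc N) zero    _         = ≡.refl
∸-suc (suc N) (suc k) (s≤s k<N) = ∸-suc N k k<N

-- Reading a path of n + d + 1 vertices from its end, vertex n is the (d+1)-st.
suc-+-∸ : ∀ n d → suc (n ℕ.+ d) ∸ n ≡ suc d
suc-+-∸ n d = ≡.trans (≡.cong (_∸ n) (≡.sym (ℕP.+-suc n d))) (ℕP.m+n∸m≡n n (suc d))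

module Tridiagonal {c ℓ} (R : CommutativeRing c ℓ) where
  open CommutativeRing R
  open LinAlg R
  open import Algebra.Properties.Ring ring
  open import Algebra.Properties.CommutativeSemigroup *-commutativeSemigroup
    using () renaming (x∙yz≈y∙xz to x*yz≈y*xz)
  open import Algebra.Properties.CommutativeSemigroup +-commutativeSemigroup
    using () renaming (xy∙z≈zy∙x to xy+z≈zy+x)
  open import Relation.Binary.Reasoning.Setoid setoid

  ≡⇒≈ : ∀ {a b} → a ≡ b → a ≈ b
  ≡⇒≈ ≡.refl = refl

  -‿cong₂ : ∀ {a a′ b b′} → a ≈ a′ → b ≈ b′ → a - b ≈ a′ - b′
  -‿cong₂ p q = +-cong p (-‿cong q)

  x-0≈x : ∀ a → a - 0# ≈ a
  x-0≈x a = trans (+-congˡ -0#≈0#) (+-identityʳ a)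

  -- The three-term recurrence read as "row of the eigenvalue equation".
  row-identity : ∀ a w p₁ p₀ → (p₀ + w * p₁) + ((a - w) * p₁ - p₀) ≈ a * p₁
  row-identity a w p₁ p₀ = begin
    (p₀ + w * p₁) + ((a - w) * p₁ - p₀)     ≈⟨ +-congˡ (-‿cong₂ ([y-z]x≈yx-zx p₁ a w) refl) ⟩
    (p₀ + w * p₁) + ((a * p₁ - w * p₁) - p₀) ≈⟨ +-congˡ (+-assoc _ _ _) ⟩
    (p₀ + w * p₁) + (a * p₁ + (- (w * p₁) - p₀)) ≈⟨ +-congˡ (+-congˡ (sym (-‿anti-homo-+ p₀ (w * p₁)))) ⟩
    (p₀ + w * p₁) + (a * p₁ - (p₀ + w * p₁)) ≈⟨ +-comm _ _ ⟩
    (a * p₁ - (p₀ + w * p₁)) + (p₀ + w * p₁) ≈⟨ +-assoc _ _ _ ⟩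
    a * p₁ + (- (p₀ + w * p₁) + (p₀ + w * p₁)) ≈⟨ +-congˡ (-‿inverseˡ _) ⟩
    a * p₁ + 0#                              ≈⟨ +-identityʳ _ ⟩
    a * p₁                                   ∎

  row-identity-scaled : ∀ g a w p₁ p₀ →
    (g * p₀ + w * (g * p₁)) + g * ((a - w) * p₁ - p₀) ≈ a * (g * p₁)
  row-identity-scaled g a w p₁ p₀ = begin
    (g * p₀ + w * (g * p₁)) + g * ((a - w) * p₁ - p₀)
      ≈⟨ +-congʳ (+-congˡ (sym (x*yz≈y*xz g w p₁))) ⟩
    (g * p₀ + g * (w * p₁)) + g * ((a - w) * p₁ - p₀)
      ≈⟨ sym (trans (distribˡ g _ _) (+-congʳ (distribˡ g p₀ _))) ⟩
    g * ((p₀ + w * p₁) + ((a - w) * p₁ - p₀)) ≈⟨ *-congˡ (row-identity a w p₁ p₀) ⟩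
    g * (a * p₁)                               ≈⟨ x*yz≈y*xz g a p₁ ⟩
    a * (g * p₁)                               ∎

  split-step : ∀ p q a A B → p * (a * A - B) - q * A ≈ (a * p - q) * A - p * B
  split-step p q a A B = begin
    p * (a * A - B) - q * A       ≈⟨ -‿cong₂ (x[y-z]≈xy-xz p (a * A) B) refl ⟩
    (p * (a * A) - p * B) - q * A ≈⟨ +-assoc _ _ _ ⟩
    p * (a * A) + (- (p * B) - q * A) ≈⟨ +-congˡ (+-comm _ _) ⟩
    p * (a * A) + (- (q * A) - p * B) ≈⟨ sym (+-assoc _ _ _) ⟩
    (p * (a * A) - q * A) - p * B ≈⟨ -‿cong₂ (-‿cong₂ (trans (sym (*-assoc p a A)) (*-congʳ (*-comm p a))) refl) refl ⟩
    ((a * p) * A - q * A) - p * B ≈⟨ -‿cong₂ (sym ([y-z]x≈yx-zx A (a * p) q)) refl ⟩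
    (a * p - q) * A - p * B       ∎

  difference-of-squares : ∀ a b → (a + b) * (a - b) ≈ a * a - b * b
  difference-of-squares a b = begin
    (a + b) * (a - b)                 ≈⟨ distribʳ (a - b) a b ⟩
    a * (a - b) + b * (a - b)         ≈⟨ +-cong (x[y-z]≈xy-xz a a b) (x[y-z]≈xy-xz b a b) ⟩
    (a * a - a * b) + (b * a - b * b) ≈⟨ +-assoc (a * a) _ _ ⟩
    a * a + (- (a * b) + (b * a - b * b)) ≈⟨ +-congˡ (sym (+-assoc _ _ _)) ⟩
    a * a + ((- (a * b) + b * a) - b * b) ≈⟨ +-congˡ (-‿cong₂ (trans (+-congˡ (*-comm b a)) (-‿inverseˡ _)) refl) ⟩
    a * a + (0# - b * b)              ≈⟨ +-congˡ (+-identityˡ _) ⟩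
    a * a - b * b                     ∎

  sumFin-cong : ∀ n {f g : Fin n → Carrier} → (∀ i → f i ≈ g i) → sumFin n f ≈ sumFin n g
  sumFin-cong zero    f≈g = refl
  sumFin-cong (suc n) f≈g = +-cong (f≈g Fin.zero) (sumFin-cong n (λ i → f≈g (Fin.suc i)))

  sumFin-zero : ∀ n {f : Fin n → Carrier} → (∀ i → f i ≈ 0#) → sumFin n f ≈ 0#
  sumFin-zero zero    f≈0 = refl
  sumFin-zero (suc n) f≈0 =
    trans (+-cong (f≈0 Fin.zero) (sumFin-zero n (λ i → f≈0 (Fin.suc i)))) (+-identityˡ 0#)

  det-cong : ∀ n {M N : Matrix n} → (∀ i j → M i j ≈ N i j) → det n M ≈ det n N
  det-cong zero    M≈N = refl
  det-cong (suc n) M≈N = sumFin-cong (suc n) λ j →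
    *-congˡ {sign (toℕ j)} (*-cong (M≈N Fin.zero j) (det-cong n (λ i k → M≈N (Fin.suc i) (punchIn j k))))

  det-zero-column : ∀ n (M : Matrix n) (col : Fin n) → (∀ i → M i col ≈ 0#) → det n M ≈ 0#
  det-zero-column (suc n) M col M·col≈0 = sumFin-zero (suc n) term
    where
    term : ∀ j → sign (toℕ j) * (M Fin.zero j * det n (minor M j)) ≈ 0#
    term j with j FinP.≟ col
    ... | yes ≡.refl = trans (*-congˡ (trans (*-congʳ (M·col≈0 Fin.zero)) (zeroˡ _))) (zeroʳ _)
    ... | no j≢col   = trans (*-congˡ (trans (*-congˡ minor≈0) (zeroʳ _))) (zeroʳ _)
      where
      minor≈0 : det n (minor M j) ≈ 0#
      minor≈0 = det-zero-column n (minor M j) (punchOut j≢col) λ i →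
        trans (≡⇒≈ (≡.cong (M (Fin.suc i)) (FinP.punchIn-punchOut j≢col))) (M·col≈0 (Fin.suc i))

  inner-minors-vanish : ∀ n (M : Matrix (suc (suc n))) →
    (∀ i → M (Fin.suc (Fin.suc i)) Fin.zero ≈ 0#) →
    (k : Fin n) → det n (minor (minor M (Fin.suc Fin.zero)) (Fin.suc k)) ≈ 0#
  inner-minors-vanish (suc n) M col₀ k =
    det-zero-column (suc n) (minor (minor M (Fin.suc Fin.zero)) (Fin.suc k)) Fin.zero col₀

  det-tridiagonal : ∀ n (M : Matrix (suc (suc n))) →
    (∀ j → M Fin.zero (Fin.suc (Fin.suc j)) ≈ 0#) →
    (∀ i → M (Fin.suc (Fin.suc i)) Fin.zero ≈ 0#) →
    det (suc (suc n)) M ≈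
      M Fin.zero Fin.zero * det (suc n) (λ i j → M (Fin.suc i) (Fin.suc j))
      - M Fin.zero (Fin.suc Fin.zero) * M (Fin.suc Fin.zero) Fin.zero
          * det n (λ i j → M (Fin.suc (Fin.suc i)) (Fin.suc (Fin.suc j)))
  det-tridiagonal n M row₀ col₀ = begin
      1# * (a * D₁) + (- 1# * (b * det (suc n) M₁) + rest)
    ≈⟨ +-cong (*-identityˡ _) (trans (+-congˡ rest≈0) (+-identityʳ _)) ⟩
      a * D₁ + (- 1# * (b * det (suc n) M₁))
    ≈⟨ +-congˡ (*-congˡ (*-congˡ minor₁)) ⟩
      a * D₁ + (- 1# * (b * (d * D₂)))
    ≈⟨ +-congˡ (trans (-1*x≈-x _) (-‿cong (sym (*-assoc b d D₂)))) ⟩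
      a * D₁ - b * d * D₂ ∎
    where
    a = M Fin.zero Fin.zero
    b = M Fin.zero (Fin.suc Fin.zero)
    d = M (Fin.suc Fin.zero) Fin.zero
    D₁ = det (suc n) (λ i j → M (Fin.suc i) (Fin.suc j))
    D₂ = det n (λ i j → M (Fin.suc (Fin.suc i)) (Fin.suc (Fin.suc j)))
    M₁ = minor M (Fin.suc Fin.zero)
    rest = sumFin n (λ j → sign (toℕ (Fin.suc (Fin.suc j)))
             * (M Fin.zero (Fin.suc (Fin.suc j)) * det (suc n) (minor M (Fin.suc (Fin.suc j)))))
    rest≈0 : rest ≈ 0#
    rest≈0 = sumFin-zero n (λ j → trans (*-congˡ (trans (*-congʳ (row₀ j)) (zeroˡ _))) (zeroʳ _))
    minor₁-rest : (k : Fin n) → det n (minor M₁ (Fin.suc k)) ≈ 0#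
    minor₁-rest = inner-minors-vanish n M col₀
    minor₁ : det (suc n) M₁ ≈ d * D₂
    minor₁ = begin
      1# * (d * D₂) + _ ≈⟨ +-cong (*-identityˡ _) (sumFin-zero n λ k →
                              trans (*-congˡ (trans (*-congˡ (minor₁-rest k)) (zeroʳ _))) (zeroʳ _)) ⟩
      d * D₂ + 0#       ≈⟨ +-identityʳ _ ⟩
      d * D₂            ∎

  charMatrix : ∀ n → (ℕ → Carrier) → Carrier → Matrix n
  charMatrix n V x = (scalarI n x ⊖ pathAdj n) ⊖ diagPot n V

  shift : ℕ → (ℕ → Carrier) → ℕ → Carrier
  shift m V j = V (m ℕ.+ j)

  -- Equality tests on Fin and ℕ commute with suc; this computes the entries
  -- of the matrices of Defs after deleting a first row and column.
  isYes-map′ : ∀ {a b} {A : Set a} {B : Set b} {f : A → B} {g : B → A} (d : Dec A) →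
    isYes (map′ f g d) ≡ isYes d
  isYes-map′ (true  because _) = ≡.refl
  isYes-map′ (false because _) = ≡.refl

  fin-≟-suc : ∀ {n} (i j : Fin n) → ⌊ Fin.suc i Fin.≟ Fin.suc j ⌋ ≡ ⌊ i Fin.≟ j ⌋
  fin-≟-suc i j = isYes-map′ (i Fin.≟ j)

  ℕ-≟-suc : ∀ a b → ⌊ suc a ℕ.≟ suc b ⌋ ≡ ⌊ a ℕ.≟ b ⌋
  ℕ-≟-suc a b = ≡.trans (isYes-map′ _) (≡.sym (isYes-map′ _))

  charMatrix-tail : ∀ n V x (i j : Fin n) →
    charMatrix (suc n) V x (Fin.suc i) (Fin.suc j) ≡ charMatrix n (shift 1 V) x i j
  charMatrix-tail n V x i j
    rewrite fin-≟-suc i j | ℕ-≟-suc (toℕ j) (suc (toℕ i)) | ℕ-≟-suc (toℕ i) (suc (toℕ j)) = ≡.refl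

  charP-one : ∀ V x → charP 1 V x ≈ x - V 1
  charP-one V x = begin
    1# * (((x - 0#) - V 1) * 1#) + 0# ≈⟨ +-identityʳ _ ⟩
    1# * (((x - 0#) - V 1) * 1#)      ≈⟨ *-identityˡ _ ⟩
    ((x - 0#) - V 1) * 1#             ≈⟨ *-identityʳ _ ⟩
    (x - 0#) - V 1                    ≈⟨ -‿cong₂ (x-0≈x x) refl ⟩
    x - V 1                           ∎

  charP-step : ∀ n V x →
    charP (suc (suc n)) V x ≈ (x - V 1) * charP (suc n) (shift 1 V) x - charP n (shift 2 V) x
  charP-step n V x = begin
    det (suc (suc n)) M
      ≈⟨ det-tridiagonal n M (λ _ → zero-entry) (λ _ → zero-entry) ⟩
    ((x - 0#) - V 1) * det (suc n) (λ i j → M (Fin.suc i) (Fin.suc j))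
      - ((0# - 1#) - 0#) * ((0# - 1#) - 0#) * det n (λ i j → M (Fin.suc (Fin.suc i)) (Fin.suc (Fin.suc j)))
      ≈⟨ -‿cong₂ (*-cong (-‿cong₂ (x-0≈x x) refl)
                         (det-cong (suc n) λ i j → ≡⇒≈ (charMatrix-tail (suc n) V x i j)))
                 (trans (*-cong minus-one-squared (det-cong n λ i j → ≡⇒≈ (tail₂ i j))) (*-identityˡ _)) ⟩
    (x - V 1) * charP (suc n) (shift 1 V) x - charP n (shift 2 V) x ∎
    where
    M = charMatrix (suc (suc n)) V x
    zero-entry : (0# - 0#) - 0# ≈ 0#
    zero-entry = trans (x-0≈x _) (x-0≈x _)
    minus-one : (0# - 1#) - 0# ≈ - 1#
    minus-one = trans (x-0≈x _) (+-identityˡ _)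
    minus-one-squared : ((0# - 1#) - 0#) * ((0# - 1#) - 0#) ≈ 1#
    minus-one-squared = trans (*-cong minus-one minus-one) (trans (-1*x≈-x _) (-‿involutive 1#))
    tail₂ : ∀ i j → M (Fin.suc (Fin.suc i)) (Fin.suc (Fin.suc j)) ≡ charMatrix n (shift 2 V) x i j
    tail₂ i j = ≡.trans (charMatrix-tail (suc n) V x (Fin.suc i) (Fin.suc j))
                        (charMatrix-tail n (shift 1 V) x i j)

  charP-step′ : ∀ k U x →
    charP (suc k) U x ≈ (x - U 1) * charP k (shift 1 U) x - pShift (shift 2 U) x k
  charP-step′ zero    U x = trans (charP-one U x) (sym (trans (-‿cong₂ (*-identityʳ _) refl) (x-0≈x _)))
  charP-step′ (suc k) U x = charP-step k U x

  Agree : ℕ → (ℕ → Carrier) → (ℕ → Carrier) → Set ℓ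
  Agree n V W = ∀ j → j < n → V (suc j) ≈ W (suc j)

  Agree-tail : ∀ {n} V W → Agree (suc n) V W → Agree n (shift 1 V) (shift 1 W)
  Agree-tail V W V≈W j j<n = V≈W (suc j) (s≤s j<n)

  Agree-pointwise : ∀ {V W} → (∀ j → V j ≡ W j) → ∀ n → Agree n V W
  Agree-pointwise V≡W n j _ = ≡⇒≈ (V≡W (suc j))

  charP-local : ∀ n V W x → Agree n V W → charP n V x ≈ charP n W x
  charP-local zero          V W x V≈W = refl
  charP-local (suc zero)    V W x V≈W =
    trans (charP-one V x) (trans (-‿cong₂ refl (V≈W 0 (s≤s z≤n))) (sym (charP-one W x)))
  charP-local (suc (suc n)) V W x V≈W = begin
    charP (suc (suc n)) V x                                            ≈⟨ charP-step n V x ⟩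
    (x - V 1) * charP (suc n) (shift 1 V) x - charP n (shift 2 V) x
      ≈⟨ -‿cong₂ (*-cong (-‿cong₂ refl (V≈W 0 (s≤s z≤n)))
                         (charP-local (suc n) (shift 1 V) (shift 1 W) x (Agree-tail V W V≈W)))
                 (charP-local n (shift 2 V) (shift 2 W) x (Agree-tail (shift 1 V) (shift 1 W) (Agree-tail V W V≈W))) ⟩
    (x - W 1) * charP (suc n) (shift 1 W) x - charP n (shift 2 W) x ≈⟨ sym (charP-step n W x) ⟩
    charP (suc (suc n)) W x                                            ∎

  pShift-local : ∀ n V W x → Agree n V W → pShift V x n ≈ pShift W x n
  pShift-local zero    V W x V≈W = refl
  pShift-local (suc n) V W x V≈W = charP-local n V W x (λ j j<n → V≈W j (ℕP.m<n⇒m<1+n j<n))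

  symPot-lower : ∀ N Q k → k ℕ.+ k < N → symPot N Q (suc k) ≡ Q (suc k)
  symPot-lower N Q k k+k<N = ≡.cong Q (nearer-lower N k k+k<N)

  symPot-upper : ∀ N Q j k → j ℕ.+ k ≡ suc N → k ≤ j → symPot N Q j ≡ Q k
  symPot-upper N Q j k sum k≤j = ≡.cong Q (nearer-upper N j k sum k≤j)

  symPot-agrees : ∀ N Q n → n ℕ.+ n ≤ N → Agree n (symPot N Q) Q
  symPot-agrees N Q n 2n≤N j j<n =
    ≡⇒≈ (symPot-lower N Q j (ℕP.<-≤-trans (ℕP.+-mono-< j<n j<n) 2n≤N))

  Reverses : ℕ → (ℕ → Carrier) → (ℕ → Carrier) → Set ℓ
  Reverses n V Q = ∀ j → j < n → V (suc j) ≈ Q (n ∸ j)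

  Reverses-tail : ∀ {n} V Q → Reverses (suc n) V Q → Reverses n (shift 1 V) Q
  Reverses-tail V Q V-rev j j<n = V-rev (suc j) (s≤s j<n)

  symPot-reverses : ∀ N Q m k → m ℕ.+ k ≡ N → k ≤ suc m → Reverses k (shift m (symPot N Q)) Q
  symPot-reverses N Q m k m+k≡N k≤1+m j j<k =
    ≡⇒≈ (symPot-upper N Q (m ℕ.+ suc j) (k ∸ j) sum bound)
    where
    sum : (m ℕ.+ suc j) ℕ.+ (k ∸ j) ≡ suc N
    sum = ≡.trans (mirrored-pair m k j (ℕP.<⇒≤ j<k)) (≡.cong suc m+k≡N)
    bound : k ∸ j ≤ m ℕ.+ suc j
    bound = ℕP.≤-trans (ℕP.m∸n≤m k j) (ℕP.≤-trans k≤1+m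
              (ℕP.≤-trans (s≤s (ℕP.m≤m+n m j)) (ℕP.≤-reflexive (≡.sym (ℕP.+-suc m j)))))

  -- Continuants: P V (k + 1) is p_k, computed by extending the path at its end.
  module Continuant (x : Carrier) where

    P : (ℕ → Carrier) → ℕ → Carrier
    P V zero          = 0#
    P V (suc zero)    = 1#
    P V (suc (suc k)) = (x - V (suc k)) * P V (suc k) - P V k

    P-local : ∀ n V W → Agree n V W → P V (suc n) ≈ P W (suc n) × P V n ≈ P W n
    P-local zero    V W V≈W = refl , refl
    P-local (suc n) V W V≈W =
      -‿cong₂ (*-cong (-‿cong₂ refl (V≈W n ℕP.≤-refl)) (proj₁ previous)) (proj₂ previous) , proj₁ previous
      where
      previous : P V (suc n) ≈ P W (suc n) × P V n ≈ P W n
      previous = P-local n V W (λ j j<n → V≈W j (ℕP.m<n⇒m<1+n j<n))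

    splitting : ∀ m k V →
      charP (m ℕ.+ k) V x ≈ P V (suc m) * charP k (shift m V) x - P V m * pShift (shift 1 (shift m V)) x k
    splitting zero    k V = sym (trans (-‿cong₂ (*-identityˡ _) (zeroˡ _)) (x-0≈x _))
    splitting (suc m) k V = begin
      charP (suc m ℕ.+ k) V x               ≡⟨ ≡.cong (λ t → charP t V x) (≡.sym (ℕP.+-suc m k)) ⟩
      charP (m ℕ.+ suc k) V x               ≈⟨ splitting m (suc k) V ⟩
      P V (suc m) * charP (suc k) (shift m V) x - P V m * charP k (shift 1 (shift m V)) x
        ≈⟨ -‿cong₂ (*-congˡ (trans (charP-step′ k (shift m V) x)
                                   (-‿cong₂ (*-cong (-‿cong₂ refl vertex) first) second))) refl ⟩
      P V (suc m) * ((x - V (suc m)) * A - B) - P V m * charP k (shift 1 (shift m V)) x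
        ≈⟨ -‿cong₂ refl (*-congˡ first) ⟩
      P V (suc m) * ((x - V (suc m)) * A - B) - P V m * A
        ≈⟨ split-step _ _ _ _ _ ⟩
      P V (suc (suc m)) * A - P V (suc m) * B ∎
      where
      A = charP k (shift (suc m) V) x
      B = pShift (shift 1 (shift (suc m) V)) x k
      vertex : V (m ℕ.+ 1) ≈ V (suc m)
      vertex = ≡⇒≈ (≡.cong V (ℕP.+-comm m 1))
      first : charP k (shift 1 (shift m V)) x ≈ A
      first = charP-local k (shift 1 (shift m V)) (shift (suc m) V) x
                (Agree-pointwise (λ j → ≡.cong V (ℕP.+-suc m j)) k)
      second : pShift (shift 2 (shift m V)) x k ≈ B
      second = pShift-local k (shift 2 (shift m V)) (shift 1 (shift (suc m) V)) x
                 (Agree-pointwise (λ j → ≡.cong V (ℕP.+-suc m (suc j))) k)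

    charP≈P : ∀ n V → charP n V x ≈ P V (suc n)
    charP≈P n V = begin
      charP n V x                   ≡⟨ ≡.cong (λ t → charP t V x) (≡.sym (ℕP.+-identityʳ n)) ⟩
      charP (n ℕ.+ 0) V x           ≈⟨ splitting n 0 V ⟩
      P V (suc n) * 1# - P V n * 0# ≈⟨ -‿cong₂ (*-identityʳ _) (zeroʳ _) ⟩
      P V (suc n) - 0#              ≈⟨ x-0≈x _ ⟩
      P V (suc n)                   ∎

    pShift≈P : ∀ n V → pShift V x n ≈ P V n
    pShift≈P zero    V = refl
    pShift≈P (suc n) V = charP≈P n V

    charP-reversed : ∀ n V Q → Reverses n V Q → charP n V x ≈ P Q (suc n)
    charP-reversed zero          V Q V-rev = refl
    charP-reversed (suc zero)    V Q V-rev = begin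
      charP 1 V x             ≈⟨ charP-one V x ⟩
      x - V 1                 ≈⟨ -‿cong₂ refl (V-rev 0 (s≤s z≤n)) ⟩
      x - Q 1                 ≈⟨ sym (trans (-‿cong₂ (*-identityʳ _) refl) (x-0≈x _)) ⟩
      (x - Q 1) * 1# - 0#     ∎
    charP-reversed (suc (suc n)) V Q V-rev = begin
      charP (suc (suc n)) V x ≈⟨ charP-step n V x ⟩
      (x - V 1) * charP (suc n) (shift 1 V) x - charP n (shift 2 V) x
        ≈⟨ -‿cong₂ (*-cong (-‿cong₂ refl (V-rev 0 (s≤s z≤n)))
                           (charP-reversed (suc n) (shift 1 V) Q tail₁))
                   (charP-reversed n (shift 2 V) Q (Reverses-tail (shift 1 V) Q tail₁)) ⟩
      P Q (suc (suc (suc n))) ∎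
      where
      tail₁ : Reverses (suc n) (shift 1 V) Q
      tail₁ = Reverses-tail V Q V-rev

    pShift-reversed : ∀ n V Q → Reverses n V Q → pShift (shift 1 V) x n ≈ P Q n
    pShift-reversed zero    V Q V-rev = refl
    pShift-reversed (suc n) V Q V-rev = charP-reversed n (shift 1 V) Q (Reverses-tail V Q V-rev)

    recurrence : ∀ Q n → charP (suc n) Q x ≈ (x - Q (suc n)) * pShift Q x (suc n) - pShift Q x n
    recurrence Q n = trans (charP≈P (suc n) Q) (sym (-‿cong₂ (*-congˡ (charP≈P n Q)) (pShift≈P n Q)))

    -- Part (2): cut the symmetric path of 2n vertices in the middle.
    even-factorization : ∀ Q n → charP (twice n) (symPot (twice n) Q) x
                                    ≈ (charP n Q x + pShift Q x n) * (charP n Q x - pShift Q x n)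
    even-factorization Q n = begin
      charP (n ℕ.+ n) W x ≈⟨ splitting n n W ⟩
      P W (suc n) * charP n (shift n W) x - P W n * pShift (shift 1 (shift n W)) x n
        ≈⟨ -‿cong₂ (*-cong (proj₁ lower) (charP-reversed n (shift n W) Q upper))
                   (*-cong (proj₂ lower) (pShift-reversed n (shift n W) Q upper)) ⟩
      P Q (suc n) * P Q (suc n) - P Q n * P Q n ≈⟨ sym (difference-of-squares _ _) ⟩
      (P Q (suc n) + P Q n) * (P Q (suc n) - P Q n)
        ≈⟨ sym (*-cong (+-cong (charP≈P n Q) (pShift≈P n Q)) (-‿cong₂ (charP≈P n Q) (pShift≈P n Q))) ⟩
      (charP n Q x + pShift Q x n) * (charP n Q x - pShift Q x n) ∎
      where
      W = symPot (n ℕ.+ n) Q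
      lower : P W (suc n) ≈ P Q (suc n) × P W n ≈ P Q n
      lower = P-local n W Q (symPot-agrees (n ℕ.+ n) Q n ℕP.≤-refl)
      upper : Reverses n (shift n W) Q
      upper = symPot-reverses (n ℕ.+ n) Q n n ≡.refl (ℕP.n≤1+n n)

    -- Part (3): cut the symmetric path of 2n + 1 vertices just before the
    -- middle vertex.
    odd-factorization : ∀ Q n → charP (suc (twice n)) (symPot (suc (twice n)) Q) x
                                   ≈ charP n Q x * (charP (suc n) Q x - pShift Q x n)
    odd-factorization Q n = begin
      charP (suc (n ℕ.+ n)) W x ≡⟨ ≡.cong (λ t → charP t W x) (≡.sym (ℕP.+-suc n n)) ⟩
      charP (n ℕ.+ suc n) W x   ≈⟨ splitting n (suc n) W ⟩
      P W (suc n) * charP (suc n) (shift n W) x - P W n * pShift (shift 1 (shift n W)) x (suc n)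
        ≈⟨ -‿cong₂ (*-cong (proj₁ lower) (charP-reversed (suc n) (shift n W) Q upper))
                   (*-cong (proj₂ lower) (pShift-reversed (suc n) (shift n W) Q upper)) ⟩
      P Q (suc n) * P Q (suc (suc n)) - P Q n * P Q (suc n)
        ≈⟨ trans (-‿cong₂ refl (*-comm _ _)) (sym (x[y-z]≈xy-xz _ _ _)) ⟩
      P Q (suc n) * (P Q (suc (suc n)) - P Q n)
        ≈⟨ sym (*-cong (charP≈P n Q) (-‿cong₂ (charP≈P (suc n) Q) (pShift≈P n Q))) ⟩
      charP n Q x * (charP (suc n) Q x - pShift Q x n) ∎
      where
      W = symPot (suc (n ℕ.+ n)) Q
      lower : P W (suc n) ≈ P Q (suc n) × P W n ≈ P Q n
      lower = P-local n W Q (symPot-agrees (suc (n ℕ.+ n)) Q n (ℕP.n≤1+n _))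
      upper : Reverses (suc n) (shift n W) Q
      upper = symPot-reverses (suc (n ℕ.+ n)) Q n (suc n) (ℕP.+-suc n n) ℕP.≤-refl

  before : (ℕ → Carrier) → ℕ → Carrier
  before g zero    = 0#
  before g (suc k) = g k

  pathRow : (ℕ → Carrier) → (ℕ → Carrier) → ℕ → Carrier
  pathRow V g k = (before g k + V (suc k) * g k) + g (suc k)

  sumℕ : ℕ → (ℕ → Carrier) → Carrier
  sumℕ zero    h = 0#
  sumℕ (suc n) h = h 0 + sumℕ n (λ l → h (suc l))

  sumℕ-cong : ∀ n {h h′ : ℕ → Carrier} → (∀ l → h l ≈ h′ l) → sumℕ n h ≈ sumℕ n h′
  sumℕ-cong zero    h≈h′ = refl
  sumℕ-cong (suc n) h≈h′ = +-cong (h≈h′ 0) (sumℕ-cong n (λ l → h≈h′ (suc l)))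

  sumℕ-zero : ∀ n h → (∀ l → h l ≈ 0#) → sumℕ n h ≈ 0#
  sumℕ-zero zero    h h≈0 = refl
  sumℕ-zero (suc n) h h≈0 = trans (+-cong (h≈0 0) (sumℕ-zero n _ (λ l → h≈0 (suc l)))) (+-identityˡ 0#)

  sumFin-toℕ : ∀ n h → sumFin n (λ j → h (toℕ j)) ≈ sumℕ n h
  sumFin-toℕ zero    h = refl
  sumFin-toℕ (suc n) h = +-congˡ (sumFin-toℕ n (λ l → h (suc l)))

  fin-≟-toℕ : ∀ {n} (i j : Fin n) → ⌊ i Fin.≟ j ⌋ ≡ ⌊ toℕ i ℕ.≟ toℕ j ⌋
  fin-≟-toℕ Fin.zero    Fin.zero    = ≡.refl
  fin-≟-toℕ Fin.zero    (Fin.suc j) = ≡.refl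
  fin-≟-toℕ (Fin.suc i) Fin.zero    = ≡.refl
  fin-≟-toℕ (Fin.suc i) (Fin.suc j) =
    ≡.trans (fin-≟-suc i j) (≡.trans (fin-≟-toℕ i j) (≡.sym (ℕ-≟-suc (toℕ i) (toℕ j))))

  Hℕ : (ℕ → Carrier) → ℕ → ℕ → Carrier
  Hℕ V k l = (if ⌊ l ℕ.≟ suc k ⌋ then 1# else (if ⌊ k ℕ.≟ suc l ⌋ then 1# else 0#))
           + (if ⌊ k ℕ.≟ l ⌋ then V (suc k) else 0#)

  H≡Hℕ : ∀ N V (i j : Fin N) → H N V i j ≡ Hℕ V (toℕ i) (toℕ j)
  H≡Hℕ N V i j rewrite fin-≟-toℕ i j = ≡.refl

  Hℕ-suc : ∀ V k l → Hℕ V (suc k) (suc l) ≡ Hℕ (shift 1 V) k l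
  Hℕ-suc V k l rewrite ℕ-≟-suc l (suc k) | ℕ-≟-suc k (suc l) | ℕ-≟-suc k l = ≡.refl

  Hℕ-first-row : ∀ V l → Hℕ V 0 (suc l) ≡ (if ⌊ l ℕ.≟ 0 ⌋ then 1# else 0#) + 0#
  Hℕ-first-row V l rewrite ℕ-≟-suc l 0 = ≡.refl

  Hℕ-first-column : ∀ V k → Hℕ V (suc k) 0 ≡ (if ⌊ k ℕ.≟ 0 ⌋ then 1# else 0#) + 0#
  Hℕ-first-column V k rewrite ℕ-≟-suc k 0 = ≡.refl

  Hℕ-row : ∀ N k V g → k < N → g N ≈ 0# → sumℕ N (λ l → Hℕ V k l * g l) ≈ pathRow V g k
  Hℕ-row (suc N) zero V g _ gN≈0 = begin
      (0# + V 1) * g 0 + sumℕ N (λ l → Hℕ V 0 (suc l) * g (suc l))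
        ≈⟨ +-congˡ (only-neighbour N (λ l → g (suc l)) gN≈0) ⟩
      (0# + V 1) * g 0 + g 1 ≈⟨ +-congʳ (trans (*-congʳ (+-identityˡ _)) (sym (+-identityˡ _))) ⟩
      (0# + V 1 * g 0) + g 1 ∎
    where
    -- in the first row only the entry of vertex 2 is off-diagonal
    only-neighbour : ∀ M (h : ℕ → Carrier) → h M ≈ 0# → sumℕ M (λ l → Hℕ V 0 (suc l) * h l) ≈ h 0
    only-neighbour zero    h hM≈0 = sym hM≈0
    only-neighbour (suc M) h hM≈0 = begin
      Hℕ V 0 1 * h 0 + sumℕ M (λ l → Hℕ V 0 (suc (suc l)) * h (suc l))
        ≈⟨ +-cong (trans (*-congʳ (+-identityʳ 1#)) (*-identityˡ _))
                  (sumℕ-zero M _ λ l → trans (*-congʳ (≡⇒≈ (Hℕ-first-row V (suc l))))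
                                              (trans (*-congʳ (+-identityʳ _)) (zeroˡ _))) ⟩
      h 0 + 0# ≈⟨ +-identityʳ _ ⟩
      h 0      ∎
  Hℕ-row (suc N) (suc k) V g (s≤s k<N) gN≈0 = begin
      Hℕ V (suc k) 0 * g 0 + sumℕ N (λ l → Hℕ V (suc k) (suc l) * g (suc l))
        ≈⟨ +-cong (*-congʳ (≡⇒≈ (Hℕ-first-column V k)))
                  (trans (sumℕ-cong N (λ l → *-congʳ (≡⇒≈ (Hℕ-suc V k l))))
                         (Hℕ-row N k (shift 1 V) (λ l → g (suc l)) k<N gN≈0)) ⟩
      ((if ⌊ k ℕ.≟ 0 ⌋ then 1# else 0#) + 0#) * g 0 + pathRow (shift 1 V) (λ l → g (suc l)) k
        ≈⟨ first-entry k ⟩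
      pathRow V g (suc k) ∎
    where
    -- the first column contributes g 0 exactly to the second row
    first-entry : ∀ k → ((if ⌊ k ℕ.≟ 0 ⌋ then 1# else 0#) + 0#) * g 0
                        + pathRow (shift 1 V) (λ l → g (suc l)) k ≈ pathRow V g (suc k)
    first-entry zero = begin
      (1# + 0#) * g 0 + ((0# + V 2 * g 1) + g 2)
        ≈⟨ +-cong (trans (*-congʳ (+-identityʳ 1#)) (*-identityˡ _)) (+-congʳ (+-identityˡ _)) ⟩
      g 0 + (V 2 * g 1 + g 2) ≈⟨ sym (+-assoc _ _ _) ⟩
      (g 0 + V 2 * g 1) + g 2 ∎
    first-entry (suc k) = trans (+-congʳ (trans (*-congʳ (+-identityʳ 0#)) (zeroˡ _))) (+-identityˡ _)

  H-apply : ∀ N V (f : Fin N → Carrier) g → (∀ j → f j ≈ g (toℕ j)) → g N ≈ 0# →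
            ∀ i → (H N V ·ᵥ f) i ≈ pathRow V g (toℕ i)
  H-apply N V f g f≈g gN≈0 i = begin
    sumFin N (λ j → H N V i j * f j)
      ≈⟨ sumFin-cong N (λ j → *-cong (≡⇒≈ (H≡Hℕ N V i j)) (f≈g j)) ⟩
    sumFin N (λ j → Hℕ V (toℕ i) (toℕ j) * g (toℕ j))
      ≈⟨ sumFin-toℕ N (λ l → Hℕ V (toℕ i) l * g l) ⟩
    sumℕ N (λ l → Hℕ V (toℕ i) l * g l)
      ≈⟨ Hℕ-row N (toℕ i) V g (FinP.toℕ<n i) gN≈0 ⟩
    pathRow V g (toℕ i) ∎

  extend : ∀ N → (Fin N → Carrier) → ℕ → Carrier
  extend N f l with l ℕ.<? N
  ... | yes l<N = f (Fin.fromℕ< l<N)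
  ... | no  _   = 0#

  extend-toℕ : ∀ N (f : Fin N → Carrier) j → f j ≈ extend N f (toℕ j)
  extend-toℕ N f j with toℕ j ℕ.<? N
  ... | yes j<N = ≡⇒≈ (≡.cong f (≡.sym (FinP.fromℕ<-toℕ j j<N)))
  ... | no  j≮N = ⊥-elim (j≮N (FinP.toℕ<n j))

  extend-end : ∀ N (f : Fin N → Carrier) → extend N f N ≈ 0#
  extend-end N f with N ℕ.<? N
  ... | yes N<N = ⊥-elim (ℕP.n≮n N N<N)
  ... | no  _   = refl

  module Eigenvectors (λ₀ : Carrier) where
    open Continuant λ₀

    -- Row k of H g = λ₀ g determines g(k+1) from g(k−1) and g(k).
    next-value : ∀ {l w a b g₀ p₀ p₁} → (l + w * a) + b ≈ λ₀ * a → l ≈ g₀ * p₀ → a ≈ g₀ * p₁ →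
                 b ≈ g₀ * ((λ₀ - w) * p₁ - p₀)
    next-value {l} {w} {a} {b} {g₀} {p₀} {p₁} row l≈ a≈ =
      +-cancelˡ (l + w * a) b _ (trans row (sym solved))
      where
      solved : (l + w * a) + g₀ * ((λ₀ - w) * p₁ - p₀) ≈ λ₀ * a
      solved = trans (+-congʳ (+-cong l≈ (*-congˡ a≈)))
                     (trans (row-identity-scaled g₀ λ₀ w p₁ p₀) (*-congˡ (sym a≈)))

    solution-unique : ∀ W g n → (∀ k → k < n → pathRow W g k ≈ λ₀ * g k) →
      ∀ k → k ≤ n → g k ≈ g 0 * P W (suc k) × before g k ≈ g 0 * P W k
    solution-unique W g n rows zero    _       = sym (*-identityʳ _) , sym (zeroʳ _)
    solution-unique W g n rows (suc k) 1+k≤n =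
      next-value (rows k 1+k≤n) (proj₂ previous) (proj₁ previous) , proj₁ previous
      where
      previous : g k ≈ g 0 * P W (suc k) × before g k ≈ g 0 * P W k
      previous = solution-unique W g n rows k (ℕP.<⇒≤ 1+k≤n)

    eigen-criterion : IsField R → ∀ m W (s : Carrier → Carrier) σ (e : ℕ → Carrier) →
      (∀ a → s a ≈ σ * a) → σ * σ ≈ 1# →
      e 0 ≈ 1# → e (suc m) ≈ 0# → e m ≈ σ → (∀ k → k < suc m → pathRow W e k ≈ λ₀ * e k) →
      EigenWithBoundary m (H (suc m) W) λ₀ s
    eigen-criterion fld m W s σ e s≈σ* σ²≈1 e₀≈1 e-end≈0 e-last≈σ e-rows =
      (e-vector , e-eigen , every e-vector e-eigen) , every
      where
      open IsField fld
      N = suc m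

      e-first-rows : ∀ k → k < m → pathRow W e k ≈ λ₀ * e k
      e-first-rows k k<m = e-rows k (ℕP.m<n⇒m<1+n k<m)

      P-last : P W (suc m) ≈ σ
      P-last = begin
        P W (suc m)           ≈⟨ sym (*-identityˡ _) ⟩
        1# * P W (suc m)      ≈⟨ *-congʳ (sym e₀≈1) ⟩
        e 0 * P W (suc m)     ≈⟨ sym (proj₁ (solution-unique W e m e-first-rows m ℕP.≤-refl)) ⟩
        e m                   ≈⟨ e-last≈σ ⟩
        σ                     ∎

      -- every eigenvector is f(1) times the continuant, hence ends in σ f(1)
      every : ∀ f → IsEigenvector N (H N W) λ₀ f →
              (f (firstV m) ≈ s (f (lastV m))) × ¬ (f (firstV m) ≈ 0#)
      every f ((i₀ , fi₀≉0) , Hf≈λf) = boundary , nonzero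
        where
        g = extend N f
        f≈g = extend-toℕ N f
        g-rows : ∀ k → k < m → pathRow W g k ≈ λ₀ * g k
        g-rows k k<m = ≡.subst (λ t → pathRow W g t ≈ λ₀ * g t) (FinP.toℕ-fromℕ< k<N)
          (trans (sym (H-apply N W f g f≈g (extend-end N f) i)) (trans (Hf≈λf i) (*-congˡ (f≈g i))))
          where
          k<N = ℕP.m<n⇒m<1+n k<m
          i = Fin.fromℕ< k<N
        g-multiple : ∀ k → k ≤ m → g k ≈ g 0 * P W (suc k)
        g-multiple k k≤m = proj₁ (solution-unique W g m g-rows k k≤m)
        boundary : f (firstV m) ≈ s (f (lastV m))
        boundary = sym (begin
          s (f (lastV m))     ≈⟨ s≈σ* _ ⟩
          σ * f (lastV m)     ≈⟨ *-congˡ (trans (f≈g (lastV m)) (≡⇒≈ (≡.cong g (FinP.toℕ-fromℕ m)))) ⟩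
          σ * g m             ≈⟨ *-congˡ (trans (g-multiple m ℕP.≤-refl) (*-congˡ P-last)) ⟩
          σ * (g 0 * σ)       ≈⟨ *-congˡ (*-comm _ _) ⟩
          σ * (σ * g 0)       ≈⟨ sym (*-assoc _ _ _) ⟩
          (σ * σ) * g 0       ≈⟨ *-congʳ σ²≈1 ⟩
          1# * g 0            ≈⟨ *-identityˡ _ ⟩
          g 0                 ≈⟨ sym (f≈g Fin.zero) ⟩
          f (firstV m)        ∎)
        nonzero : ¬ (f (firstV m) ≈ 0#)
        nonzero f₀≈0 = fi₀≉0 (begin
          f i₀                          ≈⟨ f≈g i₀ ⟩
          g (toℕ i₀)                    ≈⟨ g-multiple (toℕ i₀) (ℕ.s≤s⁻¹ (FinP.toℕ<n i₀)) ⟩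
          g 0 * P W (suc (toℕ i₀))      ≈⟨ *-congʳ (trans (sym (f≈g Fin.zero)) f₀≈0) ⟩
          0# * P W (suc (toℕ i₀))       ≈⟨ zeroˡ _ ⟩
          0#                            ∎)

      e-vector : Fin N → Carrier
      e-vector j = e (toℕ j)

      e-eigen : IsEigenvector N (H N W) λ₀ e-vector
      e-eigen = (Fin.zero , λ e₀≈0 → 1≉0 (trans (sym e₀≈1) e₀≈0))
              , λ i → trans (H-apply N W e-vector e (λ _ → refl) e-end≈0 i)
                            (e-rows (toℕ i) (FinP.toℕ<n i))

    -- The symmetric path with N = n + d + 1 vertices, d ∈ {n, n + 1}: glue the
    -- continuant solution on the vertices 1, …, n + 1 to its mirror image
    -- scaled by σ on the remaining vertices.  The two halves overlap in one
    -- value on each side of the seam; when these agree, the glued vector is a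
    -- solution of every row.
    module Mirror (Q : ℕ → Carrier) (n d : ℕ) (σ : Carrier) (n≤d : n ≤ d) (d≤1+n : d ≤ suc n)
      (seam-lower : σ * P Q d ≈ P Q (suc (suc n)))
      (seam-upper : P Q (suc n) ≈ σ * P Q (suc d)) where

      m N : ℕ
      m = n ℕ.+ d
      N = suc m

      W : ℕ → Carrier
      W = symPot N Q

      mirror : ℕ → Carrier
      mirror k with k ℕ.≤? n
      ... | yes _ = P Q (suc k)
      ... | no  _ = σ * P Q (N ∸ k)

      mirror-lower : ∀ k → k ≤ suc n → mirror k ≈ P Q (suc k)
      mirror-lower k k≤1+n with k ℕ.≤? n
      ... | yes _   = refl
      ... | no  k≰n with ℕP.≤-antisym k≤1+n (ℕP.≰⇒> k≰n)
      ...   | ≡.refl = trans (*-congˡ (≡⇒≈ (≡.cong (P Q) (ℕP.m+n∸m≡n n d)))) seam-lower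

      mirror-upper : ∀ k → n ≤ k → mirror k ≈ σ * P Q (N ∸ k)
      mirror-upper k n≤k with k ℕ.≤? n
      ... | no  _   = refl
      ... | yes k≤n with ℕP.≤-antisym k≤n n≤k
      ...   | ≡.refl = trans seam-upper (*-congˡ (≡⇒≈ (≡.cong (P Q) (≡.sym (suc-+-∸ n d)))))

      -- Up to the middle, the rows are the continuant recurrence of Q.
      lower-row : ∀ k → k ≤ n → pathRow W mirror k ≈ λ₀ * mirror k
      lower-row k k≤n = begin
        (before mirror k + W (suc k) * mirror k) + mirror (suc k)
          ≈⟨ +-cong (+-cong (previous k k≤n) (*-cong (≡⇒≈ potential) (mirror-lower k (ℕP.m≤n⇒m≤1+n k≤n))))
                    (mirror-lower (suc k) (s≤s k≤n)) ⟩
        (P Q k + Q (suc k) * P Q (suc k)) + ((λ₀ - Q (suc k)) * P Q (suc k) - P Q k)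
          ≈⟨ row-identity λ₀ _ _ _ ⟩
        λ₀ * P Q (suc k)  ≈⟨ *-congˡ (sym (mirror-lower k (ℕP.m≤n⇒m≤1+n k≤n))) ⟩
        λ₀ * mirror k     ∎
        where
        potential : W (suc k) ≡ Q (suc k)
        potential = symPot-lower N Q k (s≤s (ℕP.+-mono-≤ k≤n (ℕP.≤-trans k≤n n≤d)))
        previous : ∀ k → k ≤ n → before mirror k ≈ P Q k
        previous zero    _   = refl
        previous (suc k) 1+k≤n = mirror-lower k (ℕP.≤-trans (ℕP.n≤1+n k) (ℕP.m≤n⇒m≤1+n 1+k≤n))

      -- Past the middle, they are σ times that recurrence read from the far end.
      upper-row : ∀ k → n < k → k < N → pathRow W mirror k ≈ λ₀ * mirror k
      upper-row (suc k) (s≤s n≤k) (s≤s 1+k≤m) = begin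
        (mirror k + W (suc (suc k)) * mirror (suc k)) + mirror (suc (suc k))
          ≈⟨ +-cong (+-cong (trans (mirror-upper k n≤k) (*-congˡ (≡⇒≈ (≡.cong (P Q) reach₂))))
                            (*-cong (≡⇒≈ potential) here))
                    (mirror-upper (suc (suc k)) (ℕP.m≤n⇒m≤1+n (ℕP.m≤n⇒m≤1+n n≤k))) ⟩
        (σ * ((λ₀ - Q (suc t)) * P Q (suc t) - P Q t) + Q (suc t) * (σ * P Q (suc t))) + σ * P Q t
          ≈⟨ trans (xy+z≈zy+x _ _ _) (row-identity-scaled σ λ₀ _ _ _) ⟩
        λ₀ * (σ * P Q (suc t)) ≈⟨ *-congˡ (sym here) ⟩
        λ₀ * mirror (suc k)    ∎
        where
        t = m ∸ suc k
        k≤m = ℕP.<⇒≤ 1+k≤m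
        -- distances from the far end of the path
        reach₁ : m ∸ k ≡ suc t
        reach₁ = ∸-suc m k 1+k≤m
        reach₂ : N ∸ k ≡ suc (suc t)
        reach₂ = ≡.trans (ℕP.+-∸-assoc 1 k≤m) (≡.cong suc reach₁)
        here : mirror (suc k) ≈ σ * P Q (suc t)
        here = trans (mirror-upper (suc k) (ℕP.m≤n⇒m≤1+n n≤k)) (*-congˡ (≡⇒≈ (≡.cong (P Q) reach₁)))
        potential : W (suc (suc k)) ≡ Q (suc t)
        potential = symPot-upper N Q (suc (suc k)) (suc t) sum bound
          where
          sum : suc (suc k) ℕ.+ suc t ≡ suc N
          sum = ≡.trans (≡.cong (λ r → suc (suc (k ℕ.+ r))) (≡.sym reach₁))
                        (≡.cong (λ r → suc (suc r)) (ℕP.m+[n∸m]≡n k≤m))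
          bound : suc t ≤ suc (suc k)
          bound = ≡.subst (_≤ suc (suc k)) reach₁ (ℕP.m≤n+o⇒m∸n≤o m k
                    (ℕP.+-mono-≤ n≤k (ℕP.≤-trans d≤1+n (ℕP.≤-trans (s≤s n≤k) (ℕP.n≤1+n _)))))

      mirror-rows : ∀ k → k < N → pathRow W mirror k ≈ λ₀ * mirror k
      mirror-rows k k<N with ℕP.≤-<-connex k n
      ... | inj₁ k≤n = lower-row k k≤n
      ... | inj₂ n<k = upper-row k n<k k<N

      mirror-eigen : IsField R → (s : Carrier → Carrier) → (∀ a → s a ≈ σ * a) → σ * σ ≈ 1# →
                     EigenWithBoundary m (H N W) λ₀ s
      mirror-eigen fld s s≈σ* σ²≈1 =
        eigen-criterion fld m W s σ mirror s≈σ* σ²≈1 (mirror-lower 0 z≤n) end last mirror-rows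
        where
        n≤m = ℕP.m≤m+n n d
        end : mirror N ≈ 0#
        end = trans (mirror-upper N (ℕP.m≤n⇒m≤1+n n≤m))
                    (trans (*-congˡ (≡⇒≈ (≡.cong (P Q) (ℕP.n∸n≡0 N)))) (zeroʳ σ))
        last : mirror m ≈ σ
        last = trans (mirror-upper m n≤m)
                     (trans (*-congˡ (≡⇒≈ (≡.cong (P Q) (ℕP.m+n∸n≡m 1 m)))) (*-identityʳ σ))

    even-eigen : IsField R → ∀ Q n σ (s : Carrier → Carrier) → (∀ a → s a ≈ σ * a) → σ * σ ≈ 1# →
      P Q (suc (suc n)) ≈ σ * P Q (suc n) →
      EigenWithBoundary (suc (twice n)) (H (suc (suc (twice n))) (symPot (suc (suc (twice n))) Q)) λ₀ s
    even-eigen fld Q n σ s s≈σ* σ²≈1 seam =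
      ≡.subst (λ m → EigenWithBoundary m (H (suc m) (symPot (suc m) Q)) λ₀ s) (ℕP.+-suc n n)
        (Mirror.mirror-eigen Q n (suc n) σ (ℕP.n≤1+n n) ℕP.≤-refl (sym seam) seam-upper fld s s≈σ* σ²≈1)
      where
      seam-upper : P Q (suc n) ≈ σ * P Q (suc (suc n))
      seam-upper = sym (begin
        σ * P Q (suc (suc n))   ≈⟨ *-congˡ seam ⟩
        σ * (σ * P Q (suc n))   ≈⟨ sym (*-assoc σ σ _) ⟩
        (σ * σ) * P Q (suc n)   ≈⟨ *-congʳ σ²≈1 ⟩
        1# * P Q (suc n)        ≈⟨ *-identityˡ _ ⟩
        P Q (suc n)             ∎)

    -- N = 2n + 1: the halves share the middle vertex; they match when
    -- σ p_{n−1} = p_{n+1} and p_n = σ p_n.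
    odd-eigen : IsField R → ∀ Q n σ (s : Carrier → Carrier) → (∀ a → s a ≈ σ * a) → σ * σ ≈ 1# →
      σ * P Q n ≈ P Q (suc (suc n)) → P Q (suc n) ≈ σ * P Q (suc n) →
      EigenWithBoundary (twice n) (H (suc (twice n)) (symPot (suc (twice n)) Q)) λ₀ s
    odd-eigen fld Q n σ s s≈σ* σ²≈1 seam-lower seam-upper =
      Mirror.mirror-eigen Q n n σ ℕP.≤-refl (ℕP.n≤1+n n) seam-lower seam-upper fld s s≈σ* σ²≈1

  negation≈σ* : ∀ a → - a ≈ - 1# * a
  negation≈σ* a = sym (-1*x≈-x a)

  id≈σ* : ∀ a → a ≈ 1# * a
  id≈σ* a = sym (*-identityˡ a)

  -1²≈1 : - 1# * - 1# ≈ 1#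
  -1²≈1 = trans (-1*x≈-x _) (-‿involutive 1#)

  even-eigenvectors : IsField R → ∀ Q n λ₀ →
    (charP (suc n) Q λ₀ + pShift Q λ₀ (suc n) ≈ 0# →
       EigenWithBoundary (suc (twice n)) (H (suc (suc (twice n))) (symPot (suc (suc (twice n))) Q)) λ₀ (λ a → - a))
    × (charP (suc n) Q λ₀ - pShift Q λ₀ (suc n) ≈ 0# →
       EigenWithBoundary (suc (twice n)) (H (suc (suc (twice n))) (symPot (suc (suc (twice n))) Q)) λ₀ id)
  even-eigenvectors fld Q n λ₀ =
      (λ sum≈0 → even-eigen fld Q n (- 1#) (λ a → - a) negation≈σ* -1²≈1 (antisymmetric-seam sum≈0))
    , (λ difference≈0 → even-eigen fld Q n 1# id id≈σ* (*-identityˡ 1#) (symmetric-seam difference≈0))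
    where
    open Continuant λ₀
    open Eigenvectors λ₀

    antisymmetric-seam : charP (suc n) Q λ₀ + pShift Q λ₀ (suc n) ≈ 0# → P Q (suc (suc n)) ≈ - 1# * P Q (suc n)
    antisymmetric-seam sum≈0 = trans (+-inverseˡ-unique _ _ sum≈0′) (negation≈σ* _)
      where
      sum≈0′ : P Q (suc (suc n)) + P Q (suc n) ≈ 0#
      sum≈0′ = trans (sym (+-cong (charP≈P (suc n) Q) (charP≈P n Q))) sum≈0

    symmetric-seam : charP (suc n) Q λ₀ - pShift Q λ₀ (suc n) ≈ 0# → P Q (suc (suc n)) ≈ 1# * P Q (suc n)
    symmetric-seam difference≈0 = trans (x∙y⁻¹≈ε⇒x≈y _ _ difference≈0′) (id≈σ* _)
      where
      difference≈0′ : P Q (suc (suc n)) - P Q (suc n) ≈ 0#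
      difference≈0′ = trans (sym (-‿cong₂ (charP≈P (suc n) Q) (charP≈P n Q))) difference≈0

  odd-eigenvectors : IsField R → ∀ Q n λ₀ →
    (charP n Q λ₀ ≈ 0# →
       EigenWithBoundary (twice n) (H (suc (twice n)) (symPot (suc (twice n)) Q)) λ₀ (λ a → - a))
    × (charP (suc n) Q λ₀ - pShift Q λ₀ n ≈ 0# →
       EigenWithBoundary (twice n) (H (suc (twice n)) (symPot (suc (twice n)) Q)) λ₀ id)
  odd-eigenvectors fld Q n λ₀ = middle-vanishes , outer-agree
    where
    open Continuant λ₀
    open Eigenvectors λ₀

    -- p_n = 0: the middle entry is zero and p_{n+1} = −p_{n−1}.
    middle-vanishes : charP n Q λ₀ ≈ 0# →
       EigenWithBoundary (twice n) (H (suc (twice n)) (symPot (suc (twice n)) Q)) λ₀ (λ a → - a)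
    middle-vanishes pn≈0 = odd-eigen fld Q n (- 1#) (λ a → - a) negation≈σ* -1²≈1 seam-lower seam-upper
      where
      middle≈0 : P Q (suc n) ≈ 0#
      middle≈0 = trans (sym (charP≈P n Q)) pn≈0
      seam-lower : - 1# * P Q n ≈ P Q (suc (suc n))
      seam-lower = sym (begin
        (λ₀ - Q (suc n)) * P Q (suc n) - P Q n ≈⟨ -‿cong₂ (trans (*-congˡ middle≈0) (zeroʳ _)) refl ⟩
        0# - P Q n                            ≈⟨ +-identityˡ _ ⟩
        - P Q n                               ≈⟨ negation≈σ* _ ⟩
        - 1# * P Q n                          ∎)
      seam-upper : P Q (suc n) ≈ - 1# * P Q (suc n)
      seam-upper = trans middle≈0 (sym (trans (*-congˡ middle≈0) (zeroʳ _)))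

    -- p_{n+1} = p_{n−1}: the mirror image is the same solution.
    outer-agree : charP (suc n) Q λ₀ - pShift Q λ₀ n ≈ 0# →
       EigenWithBoundary (twice n) (H (suc (twice n)) (symPot (suc (twice n)) Q)) λ₀ id
    outer-agree difference≈0 = odd-eigen fld Q n 1# id id≈σ* (*-identityˡ 1#) seam-lower (id≈σ* _)
      where
      seam-lower : 1# * P Q n ≈ P Q (suc (suc n))
      seam-lower = trans (*-identityˡ _) (sym (x∙y⁻¹≈ε⇒x≈y _ _
                     (trans (sym (-‿cong₂ (charP≈P (suc n) Q) (pShift≈P n Q))) difference≈0)))

lemma2 : ∀ {c ℓ} (R : CommutativeRing c ℓ) → IsField R →
    let open CommutativeRing R
        open LinAlg R
    in (Q : ℕ → Carrier) →
       ((x : Carrier) (n : ℕ) →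
          charP (suc n) Q x ≈ (x - Q (suc n)) * pShift Q x (suc n) - pShift Q x n)
     × ((x : Carrier) (n : ℕ) →
          charP (twice n) (symPot (twice n) Q) x
            ≈ (charP n Q x + pShift Q x n) * (charP n Q x - pShift Q x n))
     × ((x : Carrier) (n : ℕ) →
          charP (suc (twice n)) (symPot (suc (twice n)) Q) x
            ≈ charP n Q x * (charP (suc n) Q x - pShift Q x n))
     × ((n : ℕ) (λ₀ : Carrier) →
          (charP (suc n) Q λ₀ + pShift Q λ₀ (suc n) ≈ 0# →
             EigenWithBoundary (suc (twice n)) (H (suc (suc (twice n))) (symPot (suc (suc (twice n))) Q)) λ₀ (λ a → - a))
        × (charP (suc n) Q λ₀ - pShift Q λ₀ (suc n) ≈ 0# →
             EigenWithBoundary (suc (twice n)) (H (suc (suc (twice n))) (symPot (suc (suc (twice n))) Q)) λ₀ id))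
     × ((n : ℕ) (λ₀ : Carrier) →
          (charP n Q λ₀ ≈ 0# →
             EigenWithBoundary (twice n) (H (suc (twice n)) (symPot (suc (twice n)) Q)) λ₀ (λ a → - a))
        × (charP (suc n) Q λ₀ - pShift Q λ₀ n ≈ 0# →
             EigenWithBoundary (twice n) (H (suc (twice n)) (symPot (suc (twice n)) Q)) λ₀ id))
lemma2 R isField Q =
    (λ x n → Continuant.recurrence x Q n)
  , (λ x n → Continuant.even-factorization x Q n)
  , (λ x n → Continuant.odd-factorization x Q n)
  , (λ n λ₀ → even-eigenvectors isField Q n λ₀)
  , (λ n λ₀ → odd-eigenvectors isField Q n λ₀)
  where open Tridiagonal R
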